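{- The period-doubling sequence $\mathbf{pd}$ is $3$-pseudoperiodic, but not $2$-pseudoperiodic.
   Context: The period-doubling sequence $\mathbf{pd}=1011101011\cdots$ is the infinite fixed point, starting with $1$, of the morphism $1\mapsto10$, $0\mapsto11$; it is indexed from $0$. For integers $k\ge1$ and $0<p_1<\cdots<p_k$, an infinite word $\mathbf{s}$ has pseudoperiod $(p_1,\ldots,p_k)$ if $\mathbf{s}[i]\in\{\mathbf{s}[i+p_1],\ldots,\mathbf{s}[i+p_k]\}$ for all $i\ge0$; it is $k$-pseudoperiodic if it has some pseudoperiod with exactly $k$ entries. -}

module Defs where

open import Data.Unit using (⊤)
open import Data.Bool using (Bool; true; false)
open import Data.Nat using (ℕ; zero; suc; _+_; _<_)
open import Data.Nat.DivMod using (_/_; _%_)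
open import Data.Fin using (Fin; zero; suc)
open import Data.Vec using (Vec; _∷_; []; lookup)
open import Data.Product using (Σ; ∃; _×_)
open import Data.Sum using (_⊎_)
open import Relation.Binary.PropositionalEquality using (_≡_)

-- Letters 1 and 0 are represented by true and false.
-- The period-doubling morphism: 1 ↦ 10, 0 ↦ 11, as a map letter → position (0/1) → letter.
μ : Bool → Bool → Bool
μ true  false = true
μ true  true  = false
μ false false = true
μ false true  = true

-- position n of μ^∞(1): pd[n] = μ(pd[⌊n/2⌋])[n mod 2], pd[0] = 1.
-- Computed with fuel (fuel ≥ n suffices, since ⌊n/2⌋ < n for n > 0).
pdAux : ℕ → ℕ → Bool
pdAux zero    n = true
pdAux (suc f) zero = true
pdAux (suc f) (suc n) = μ (pdAux f ((suc n) / 2)) (parity (suc n % 2))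
  where
  parity : ℕ → Bool
  parity zero = false
  parity (suc _) = true

pd : ℕ → Bool
pd n = pdAux n n

StrictlyIncreasingPos : {k : ℕ} → Vec ℕ k → Set
StrictlyIncreasingPos [] = ⊤
StrictlyIncreasingPos (p ∷ ps) = (0 < p) × Inc p ps
  where
  Inc : {k : ℕ} → ℕ → Vec ℕ k → Set
  Inc q [] = ⊤
  Inc q (r ∷ rs) = (q < r) × Inc r rs

HasPseudoperiod : (ℕ → Bool) → {k : ℕ} → Vec ℕ k → Set
HasPseudoperiod s {k} p =
  StrictlyIncreasingPos p ×
  ((i : ℕ) → ∃ λ (j : Fin k) → s i ≡ s (i + lookup p j))

Pseudoperiodic : ℕ → (ℕ → Bool) → Set
Pseudoperiodic k s = ∃ λ (p : Vec ℕ k) → HasPseudoperiod s p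

{-# OPTIONS --safe #-}
module Submission where

-- Even positions of pd carry 1 and pd (2k+1) = not (pd k), so positions 4m+1 carry 0.
-- Pseudoperiod (1,2,4): an even position is matched two steps later, a 1 at an odd position
-- one step later, and a 0 sits at 4m+1 or 4m+3, matched by 4m+5.
-- No pseudoperiod (p,q): call i a flip over r when pd (i + r) ≠ pd i. A flip over r at i gives
-- one over 2r at 2i+1, so by halving every r ≥ 1 has flips starting at either letter, and any
-- p, q ≥ 1 share a flip: if p is odd, 2m+1 is a flip over p whenever pd m = 1 (2m+1+p is
-- even), and over q = 2h too if moreover pd (m + h) = 0; if both are even, double a common
-- flip of p/2 and q/2. At a common flip neither shift repeats the letter.

open import Defs
open import Data.Bool using (true; false; not)
open import Data.Bool.Properties using (not-involutive; not-¬)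
open import Data.Fin using (Fin; zero; suc)
open import Data.Nat using (ℕ; zero; suc; _+_; _*_; _≤_; _<_; z≤n; s≤s)
open import Data.Nat.DivMod using (_/_; _%_; [m+kn]%n≡m%n; +-distrib-/; m*n%n≡0; m*n/n≡m; m/n<m)
open import Data.Nat.Induction using (<-rec)
open import Data.Nat.Properties using (+-suc; m<m+n; m≤m+n; <⇒≤pred; ≤-refl; ≤-trans; <-trans)
open import Data.Nat.Tactic.RingSolver using (solve-∀)
open import Data.Product using (_×_; _,_; ∃)
open import Data.Unit using (tt)
open import Data.Vec using (_∷_; []; lookup)
open import Function using (_∘_)
open import Relation.Nullary using (¬_)
open import Relation.Binary.PropositionalEquality
open ≡-Reasoning

data Parity : ℕ → Set where
  even : ∀ k → Parity (k + k)
  odd  : ∀ k → Parity (suc (k + k))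

parity : ∀ n → Parity n
parity zero = even 0
parity (suc n) with parity n
... | even k = odd k
... | odd k  = subst Parity (cong suc (+-suc k k)) (even (suc k))

halving-induction : ∀ {ℓ} (P : ℕ → Set ℓ) → P 0 → (∀ k → P (suc (k + k))) →
                    (∀ k → P (suc k) → P (suc k + suc k)) → ∀ n → P n
halving-induction P P0 Podd Peven = <-rec P step
  where
  step : ∀ n → (∀ {m} → m < n → P m) → P n
  step n rec with parity n
  ... | odd k        = Podd k
  ... | even zero    = P0
  ... | even (suc k) = Peven k (rec (m<m+n (suc k) (s≤s z≤n)))

k+k≡k*2 : ∀ k → k + k ≡ k * 2
k+k≡k*2 = solve-∀

[1+k+k]%2≡1 : ∀ k → suc (k + k) % 2 ≡ 1
[1+k+k]%2≡1 k rewrite k+k≡k*2 k = [m+kn]%n≡m%n 1 k 2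

[1+k+k]/2≡k : ∀ k → suc (k + k) / 2 ≡ k
[1+k+k]/2≡k k rewrite k+k≡k*2 k = begin
  (1 + k * 2) / 2         ≡⟨ +-distrib-/ 1 (k * 2) (subst (λ r → 1 + r < 2) (sym (m*n%n≡0 k 2)) ≤-refl) ⟩
  1 / 2 + k * 2 / 2       ≡⟨ cong (0 +_) (m*n/n≡m k 2) ⟩
  k                       ∎

[k+k]%2≡0 : ∀ k → (k + k) % 2 ≡ 0
[k+k]%2≡0 k rewrite k+k≡k*2 k = m*n%n≡0 k 2

[1+n]/2≤n : ∀ n → suc n / 2 ≤ n
[1+n]/2≤n n = <⇒≤pred (m/n<m (suc n) 2 (s≤s (s≤s z≤n)))

pdAux-fuel-irrelevant : ∀ f g n → n ≤ f → n ≤ g → pdAux f n ≡ pdAux g n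
pdAux-fuel-irrelevant zero    zero    zero    _         _         = refl
pdAux-fuel-irrelevant zero    (suc g) zero    _         _         = refl
pdAux-fuel-irrelevant (suc f) zero    zero    _         _         = refl
pdAux-fuel-irrelevant (suc f) (suc g) zero    _         _         = refl
pdAux-fuel-irrelevant (suc f) (suc g) (suc n) (s≤s n≤f) (s≤s n≤g)
  rewrite pdAux-fuel-irrelevant f g (suc n / 2) (≤-trans ([1+n]/2≤n n) n≤f) (≤-trans ([1+n]/2≤n n) n≤g)
  with suc n % 2
... | zero  = refl
... | suc _ = refl

μ-second-0 : ∀ x → μ x false ≡ true
μ-second-0 true  = refl
μ-second-0 false = refl

μ-second-1 : ∀ x → μ x true ≡ not x
μ-second-1 true  = refl
μ-second-1 false = refl

pd-even : ∀ k → pd (k + k) ≡ true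
pd-even zero = refl
pd-even (suc k) rewrite [k+k]%2≡0 (suc k) = μ-second-0 _

pd-odd : ∀ k → pd (suc (k + k)) ≡ not (pd k)
pd-odd k rewrite [1+k+k]%2≡1 k | [1+k+k]/2≡k k =
  trans (μ-second-1 _) (cong not (pdAux-fuel-irrelevant (k + k) k k (m≤m+n k k) ≤-refl))

pd-4k+1 : ∀ k → pd (suc ((k + k) + (k + k))) ≡ false
pd-4k+1 k = trans (pd-odd (k + k)) (cong not (pd-even k))

pd-has-pseudoperiod-1-2-4 : HasPseudoperiod pd (1 ∷ 2 ∷ 4 ∷ [])
pd-has-pseudoperiod-1-2-4 = (s≤s z≤n , s≤s (s≤s z≤n) , s≤s (s≤s (s≤s z≤n)) , tt) , shift
  where
  k+k+2≡[1+k]+[1+k] : ∀ k → k + k + 2 ≡ suc k + suc k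
  k+k+2≡[1+k]+[1+k] = solve-∀
  1+k+k+1≡[1+k]+[1+k] : ∀ k → suc (k + k) + 1 ≡ suc k + suc k
  1+k+k+1≡[1+k]+[1+k] = solve-∀
  4m+1+4≡4[1+m]+1 : ∀ m → suc (m + m + (m + m)) + 4 ≡ suc (suc m + suc m + (suc m + suc m))
  4m+1+4≡4[1+m]+1 = solve-∀
  4m+3+2≡4[1+m]+1 : ∀ m → suc (suc (m + m) + suc (m + m)) + 2 ≡ suc (suc m + suc m + (suc m + suc m))
  4m+3+2≡4[1+m]+1 = solve-∀

  shift : ∀ i → ∃ λ (j : Fin 3) → pd i ≡ pd (i + lookup (1 ∷ 2 ∷ 4 ∷ []) j)
  shift i with parity i
  ... | even k = suc zero , (begin
    pd (k + k)            ≡⟨ pd-even k ⟩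
    true                  ≡⟨ pd-even (suc k) ⟨
    pd (suc k + suc k)    ≡⟨ cong pd (k+k+2≡[1+k]+[1+k] k) ⟨
    pd (k + k + 2)        ∎)
  ... | odd k with pd k in pd-k
  ... | false = zero , (begin
    pd (suc (k + k))      ≡⟨ pd-odd k ⟩
    not (pd k)            ≡⟨ cong not pd-k ⟩
    true                  ≡⟨ pd-even (suc k) ⟨
    pd (suc k + suc k)    ≡⟨ cong pd (1+k+k+1≡[1+k]+[1+k] k) ⟨
    pd (suc (k + k) + 1)  ∎)
  ... | true with parity k
  ... | even m = suc (suc zero) , (begin
    pd (suc (m + m + (m + m)))                    ≡⟨ pd-4k+1 m ⟩
    false                                         ≡⟨ pd-4k+1 (suc m) ⟨
    pd (suc (suc m + suc m + (suc m + suc m)))    ≡⟨ cong pd (4m+1+4≡4[1+m]+1 m) ⟨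
    pd (suc (m + m + (m + m)) + 4)                ∎)
  ... | odd m = suc zero , (begin
    pd (suc (suc (m + m) + suc (m + m)))          ≡⟨ pd-odd (suc (m + m)) ⟩
    not (pd (suc (m + m)))                        ≡⟨ cong not pd-k ⟩
    false                                         ≡⟨ pd-4k+1 (suc m) ⟨
    pd (suc (suc m + suc m + (suc m + suc m)))    ≡⟨ cong pd (4m+3+2≡4[1+m]+1 m) ⟨
    pd (suc (suc (m + m) + suc (m + m)) + 2)      ∎)


Flips : ℕ → ℕ → Set
Flips r i = pd (i + r) ≡ not (pd i)

flips-double : ∀ r i → Flips r i → Flips (r + r) (suc (i + i))
flips-double r i flip = begin
  pd (suc (i + i) + (r + r))    ≡⟨ cong pd (1+i+i+[r+r]≡1+[i+r]+[i+r] i r) ⟩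
  pd (suc ((i + r) + (i + r)))  ≡⟨ pd-odd (i + r) ⟩
  not (pd (i + r))              ≡⟨ cong not flip ⟩
  not (not (pd i))              ≡⟨ cong not (pd-odd i) ⟨
  not (pd (suc (i + i)))        ∎
  where
  1+i+i+[r+r]≡1+[i+r]+[i+r] : ∀ i r → suc (i + i) + (r + r) ≡ suc ((i + r) + (i + r))
  1+i+i+[r+r]≡1+[i+r]+[i+r] = solve-∀

flips-odd : ∀ m a → pd m ≡ true → Flips (suc (a + a)) (suc (m + m))
flips-odd m a pd-m = begin
  pd (suc (m + m) + suc (a + a))    ≡⟨ cong pd (1+m+m+[1+a+a]≡[1+m+a]+[1+m+a] m a) ⟩
  pd ((suc m + a) + (suc m + a))    ≡⟨ pd-even (suc m + a) ⟩
  not (not true)                    ≡⟨ cong (not ∘ not) pd-m ⟨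
  not (not (pd m))                  ≡⟨ cong not (pd-odd m) ⟨
  not (pd (suc (m + m)))            ∎
  where
  1+m+m+[1+a+a]≡[1+m+a]+[1+m+a] : ∀ m a → suc (m + m) + suc (a + a) ≡ (suc m + a) + (suc m + a)
  1+m+m+[1+a+a]≡[1+m+a]+[1+m+a] = solve-∀

pd-flips-at-every-distance : ∀ r → 0 < r → ∀ b → ∃ λ i → pd i ≡ b × Flips r i
pd-flips-at-every-distance = halving-induction _ (λ ()) odd-distance even-distance
  where
  2+[4u+3]≡4[1+u]+1 : ∀ u → 2 + suc (suc (u + u) + suc (u + u)) ≡ suc ((suc u + suc u) + (suc u + suc u))
  2+[4u+3]≡4[1+u]+1 = solve-∀

  odd-distance : ∀ t → 0 < suc (t + t) → ∀ b → ∃ λ i → pd i ≡ b × Flips (suc (t + t)) i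
  odd-distance t _ false = 1 , refl , flips-odd 0 t refl
  odd-distance t _ true with parity t
  ... | even u = 0 , refl , pd-4k+1 u
  ... | odd u  = 2 , refl , trans (cong pd (2+[4u+3]≡4[1+u]+1 u)) (pd-4k+1 (suc u))

  even-distance : ∀ s → (0 < suc s → ∀ b → ∃ λ i → pd i ≡ b × Flips (suc s) i) →
                  0 < suc s + suc s → ∀ b → ∃ λ i → pd i ≡ b × Flips (suc s + suc s) i
  even-distance s ih _ b with ih (s≤s z≤n) (not b)
  ... | i , pd-i , flip =
    suc (i + i) , trans (pd-odd i) (trans (cong not pd-i) (not-involutive b)) , flips-double (suc s) i flip

pd-flips-simultaneously : ∀ p q → 0 < p → 0 < q → ∃ λ i → Flips p i × Flips q i
pd-flips-simultaneously = halving-induction _ (λ _ ()) odd-first even-first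
  where
  odd-first : ∀ a q → 0 < suc (a + a) → 0 < q → ∃ λ i → Flips (suc (a + a)) i × Flips q i
  odd-first a q _ 0<q with parity q
  ... | odd b        = 1 , flips-odd 0 a refl , flips-odd 0 b refl
  ... | even (suc b) with pd-flips-at-every-distance (suc b) (s≤s z≤n) true
  ...   | m , pd-m , flip = suc (m + m) , flips-odd m a pd-m , flips-double (suc b) m flip
  even-first : ∀ a → (∀ q → 0 < suc a → 0 < q → ∃ λ i → Flips (suc a) i × Flips q i) →
               ∀ q → 0 < suc a + suc a → 0 < q → ∃ λ i → Flips (suc a + suc a) i × Flips q i
  even-first a ih q _ 0<q with parity q
  ... | odd b with pd-flips-at-every-distance (suc a) (s≤s z≤n) true
  ...   | m , pd-m , flip = suc (m + m) , flips-double (suc a) m flip , flips-odd m b pd-m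
  even-first a ih q _ 0<q | even (suc b) with ih (suc b) (s≤s z≤n) (s≤s z≤n)
  ...   | i , flip-a , flip-b =
    suc (i + i) , flips-double (suc a) i flip-a , flips-double (suc b) i flip-b

pd-not-2-pseudoperiodic : ¬ Pseudoperiodic 2 pd
pd-not-2-pseudoperiodic ((p ∷ q ∷ []) , (0<p , p<q , _) , pseudo)
  with pd-flips-simultaneously p q 0<p (<-trans 0<p p<q)
... | i , flip-p , flip-q with pseudo i
... | zero     , same = not-¬ (sym same) flip-p
... | suc zero , same = not-¬ (sym same) flip-q

proposition25 : Pseudoperiodic 3 pd × ¬ Pseudoperiodic 2 pd
proposition25 = (_ , pd-has-pseudoperiod-1-2-4) , pd-not-2-pseudoperiodic
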